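{- Let $u,v\in\mathfrak S_n$ (with simple transpositions $\tau_i=(i,i+1)$ as generators). The following are equivalent: (1) $u\le v$; (2) $\mathrm{std}_{C(u)}(v)=u$; (3) $C(v)\subseteq C(u)$ and $\mathrm{std}_{C(u)}(v)=\mathrm{std}_{C(u)}(u)$.
   Context: For $w\in\mathfrak S_n$, $S(w)$ is the set of $\tau_i$ occurring in a reduced expression of $w$, $C(w)=\{\tau_1,\dots,\tau_{n-1}\}\setminus S(w)$. For $I\subseteq S$, $w=w^Iw_I$ is the unique factorization with $w_I$ in the subgroup $W_I$ generated by $I$ and $w^I$ satisfying $\ell(w^Is)>\ell(w^I)$ for all $s\in I$ ($\ell$ = number of inversions). The order: $u\le v$ iff $v_{S(u)}=u$. Standardization: for a word $a_1\cdots a_m$ of distinct-or-not letters in a totally ordered alphabet, $\mathrm{std}$ is the unique $\sigma\in\mathfrak S_m$ with $\sigma(i)>\sigma(j)\iff a_i>a_j$ for $i<j$. For $T=\{\tau_{i_1},\dots,\tau_{i_k}\}$ with $i_1<\dots<i_k$, cut the one-line word of $w$ into consecutive factors $w_1,\dots,w_{k+1}$ of lengths $i_1,i_2-i_1,\dots,n-i_k$ and set $\mathrm{std}_T(w)=\mathrm{std}(w_1)\times\cdots\times\mathrm{std}(w_{k+1})$, where $\sigma_1\times\cdots\times\sigma_{k+1}$ acts on the $r$-th block of positions by $\sigma_r$ shifted by the block's offset (e.g. $\mathrm{std}_{\{\tau_1,\tau_4\}}(462351)=142365$). -}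

module Defs where

open import Data.Nat as ℕ using (ℕ; zero; suc; _∸_)
open import Data.Fin as Fin using (Fin; toℕ)
open import Data.Vec using (Vec; []; _∷_; lookup; map; allFin)
open import Data.List as List using (List; length; filter; cartesianProduct)
open import Data.List.Membership.Propositional using (_∈_)
open import Data.List.Relation.Unary.All using (All)
open import Data.Product using (Σ; _×_; _,_; ∃)
open import Relation.Nullary using (¬_)
open import Relation.Nullary.Decidable using (_×-dec_)
open import Relation.Binary.PropositionalEquality using (_≡_)

-- Elements of 𝔖ₙ in one-line notation: w = w(0) w(1) ... w(n-1)
-- (positions and values 0-based; the paper's letters 1..n are shifted by one).
Word : ℕ → Set
Word n = Vec (Fin n) n

IsPerm : ∀ {n} → Word n → Set
IsPerm {n} w = ∀ (i j : Fin n) → lookup w i ≡ lookup w j → i ≡ j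

idW : ∀ {n} → Word n
idW {n} = allFin n

_·_ : ∀ {n} → Word n → Word n → Word n
u · v = map (lookup u) v

swapAdj : ∀ {A : Set} {n} → ℕ → Vec A n → Vec A n
swapAdj zero    (x ∷ y ∷ xs) = y ∷ x ∷ xs
swapAdj (suc k) (x ∷ xs)     = x ∷ swapAdj k xs
swapAdj _       xs           = xs

-- right multiplication by the simple transposition τᵢ = (i, i+1)
-- (i is the paper's 1-based index, 1 ≤ i ≤ n-1): w·τᵢ swaps entries i, i+1
_·τ_ : ∀ {n} → Word n → ℕ → Word n
w ·τ i = swapAdj (i ∸ 1) w

ValidGen : ℕ → ℕ → Set
ValidGen n i = 1 ℕ.≤ i × suc i ℕ.≤ n

evalGens : ∀ {n} → List ℕ → Word n
evalGens ws = List.foldl _·τ_ idW ws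

ℓ : ∀ {n} → Word n → ℕ
ℓ {n} w = length (filter (λ p → (Data.Product.proj₁ p Fin.<? Data.Product.proj₂ p)
                                ×-dec (lookup w (Data.Product.proj₂ p) Fin.<? lookup w (Data.Product.proj₁ p)))
                         (cartesianProduct (List.allFin n) (List.allFin n)))

-- sets of simple transpositions, given by their (1-based) indices
GenSet : Set₁
GenSet = ℕ → Set

IsReducedExpr : ∀ {n} → Word n → List ℕ → Set
IsReducedExpr {n} w ws = All (ValidGen n) ws × evalGens ws ≡ w × length ws ≡ ℓ w

Supp : ∀ {n} → Word n → GenSet
Supp w i = ∃ λ ws → IsReducedExpr w ws × i ∈ ws

Cw : ∀ {n} → Word n → GenSet
Cw {n} w i = ValidGen n i × ¬ Supp w i

_⊆G_ : GenSet → GenSet → Set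
A ⊆G B = ∀ i → A i → B i

InParabolic : ∀ {n} → GenSet → Word n → Set
InParabolic {n} I x = ∃ λ ws → All (ValidGen n) ws × All I ws × evalGens ws ≡ x

-- x = w_I, i.e. w = w^I w_I with w_I ∈ W_I and ℓ(w^I s) > ℓ(w^I) for all s ∈ I
IsParabolicPart : ∀ {n} → GenSet → Word n → Word n → Set
IsParabolicPart {n} I w x =
  InParabolic I x ×
  (∃ λ (y : Word n) → w ≡ y · x × (∀ i → ValidGen n i → I i → ℓ y ℕ.< ℓ (y ·τ i)))

_≼_ : ∀ {n} → Word n → Word n → Set
u ≼ v = IsParabolicPart (Supp u) v u

-- 0-based positions p and q lie in the same factor when cutting the one-line word
-- after the first i letters for every τᵢ ∈ T
SameBlock : ∀ {n} → GenSet → Fin n → Fin n → Set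
SameBlock T p q = ∀ i → T i →
  ¬ (toℕ p ℕ.< i × i ℕ.≤ toℕ q) × ¬ (toℕ q ℕ.< i × i ℕ.≤ toℕ p)

-- σ = std_T(w): σ = std(w₁) × ⋯ × std(w_{k+1}), i.e. σ is a permutation mapping each
-- block of positions to itself, and within a block σ(p) > σ(q) ⇔ w(p) > w(q) for p < q
IsStdT : ∀ {n} → GenSet → Word n → Word n → Set
IsStdT {n} T w σ =
  IsPerm σ ×
  (∀ p → SameBlock T p (lookup σ p)) ×
  (∀ p q → p Fin.< q → SameBlock T p q →
     (lookup σ q Fin.< lookup σ p → lookup w q Fin.< lookup w p) ×
     (lookup w q Fin.< lookup w p → lookup σ q Fin.< lookup σ p))

-- Positions are 0-based, so τ_c exchanges positions c - 1 and c; call the gap between them cut c.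
-- Along a reduced expression every letter raises the length, so a letter τ_c creates an inversion
-- across cut c and later letters keep it there; conversely, if τ_c is not used, no position ever moves
-- across cut c. Hence τ_c ∈ S(w) iff w has an inversion across cut c iff w moves a position across
-- cut c. So u maps each block of positions cut out by C(u) into itself, and y has an ascent at every
-- τ_i ∈ S(u) iff y is increasing on these blocks. For v = y·u this says that v and u order the
-- positions of each block alike, i.e. std_{C(u)}(v) = u. Since an inversion of u across a cut
-- τ_i ∈ S(u) lies inside a block, y keeps it an inversion of v, whence S(u) ⊆ S(v).

module Submission where

open import Defs
open import Data.Nat as ℕ using (ℕ; zero; suc; _+_; _∸_; z≤n; s≤s)
import Data.Nat.Properties as ℕP
open import Data.Nat.Tactic.RingSolver using (solve-∀)
open import Algebra.Properties.CommutativeSemigroup ℕP.+-commutativeSemigroup using (x∙yz≈y∙xz)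
open import Data.Fin as F using (Fin; toℕ; fromℕ<)
import Data.Fin.Properties as FP
open import Data.Vec as V using (Vec; []; _∷_; lookup)
import Data.Vec.Properties as VP
open import Data.List as L using (List; length; filter; cartesianProduct; tabulate)
import Data.List.Properties as LP
open import Data.List.Membership.Propositional using (_∈_)
open import Data.List.Membership.DecPropositional ℕ._≟_ using (_∈?_)
open import Data.List.Relation.Unary.Any using (here; there)
open import Data.List.Relation.Unary.All as All using (All)
import Data.List.Relation.Unary.All.Properties as AllP
open import Data.Product using (Σ; ∃; ∃₂; _×_; _,_; proj₁; proj₂)
open import Data.Sum using (_⊎_; inj₁; inj₂)
open import Data.Empty using (⊥-elim)
open import Function using (_∘_)
open import Function.Bundles using (_⇔_; mk⇔)
open import Level using (0ℓ)
open import Relation.Binary using (tri<; tri≈; tri>)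
open import Relation.Binary.PropositionalEquality
open import Relation.Nullary using (¬_; Dec; yes; no)
open import Relation.Nullary.Decidable using (_×-dec_)
open import Relation.Unary using (Pred; Decidable)

private
  variable
    n m : ℕ

-- Adjacent transpositions of positions

swapIdx : ℕ → Fin n → Fin n
swapIdx {suc (suc n)} zero F.zero             = F.suc F.zero
swapIdx {suc (suc n)} zero (F.suc F.zero)     = F.zero
swapIdx {suc (suc n)} zero (F.suc (F.suc p))  = F.suc (F.suc p)
swapIdx {suc zero}    zero p                  = p
swapIdx (suc k) F.zero    = F.zero
swapIdx (suc k) (F.suc p) = F.suc (swapIdx k p)

lookup-swapAdj : ∀ {A : Set} k (xs : Vec A n) p → lookup (swapAdj k xs) p ≡ lookup xs (swapIdx k p)
lookup-swapAdj zero    (x ∷ y ∷ xs) F.zero            = refl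
lookup-swapAdj zero    (x ∷ y ∷ xs) (F.suc F.zero)    = refl
lookup-swapAdj zero    (x ∷ y ∷ xs) (F.suc (F.suc p)) = refl
lookup-swapAdj zero    (x ∷ [])     F.zero            = refl
lookup-swapAdj (suc k) (x ∷ xs)     F.zero            = refl
lookup-swapAdj (suc k) (x ∷ xs)     (F.suc p)         = lookup-swapAdj k xs p

swapIdx-involutive : ∀ k (p : Fin n) → swapIdx k (swapIdx k p) ≡ p
swapIdx-involutive {suc (suc n)} zero F.zero             = refl
swapIdx-involutive {suc (suc n)} zero (F.suc F.zero)     = refl
swapIdx-involutive {suc (suc n)} zero (F.suc (F.suc p))  = refl
swapIdx-involutive {suc zero}    zero F.zero             = refl
swapIdx-involutive (suc k) F.zero    = refl
swapIdx-involutive (suc k) (F.suc p) = cong F.suc (swapIdx-involutive k p)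

toℕ-swapIdx-left : ∀ k (p : Fin n) → toℕ p ≡ k → suc k ℕ.< n → toℕ (swapIdx k p) ≡ suc k
toℕ-swapIdx-left {suc (suc n)} zero    F.zero    _ _ = refl
toℕ-swapIdx-left {suc zero}    zero    F.zero    _ (s≤s ())
toℕ-swapIdx-left               (suc k) (F.suc p) e (s≤s k+1<n) =
  cong suc (toℕ-swapIdx-left k p (ℕP.suc-injective e) k+1<n)

toℕ-swapIdx-right : ∀ k (p : Fin n) → toℕ p ≡ suc k → toℕ (swapIdx k p) ≡ k
toℕ-swapIdx-right {suc (suc n)} zero    (F.suc F.zero)     _  = refl
toℕ-swapIdx-right {suc (suc n)} zero    (F.suc (F.suc p))  ()
toℕ-swapIdx-right               (suc k) (F.suc p)          e  =
  cong suc (toℕ-swapIdx-right k p (ℕP.suc-injective e))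

swapIdx-other : ∀ k (p : Fin n) → toℕ p ≢ k → toℕ p ≢ suc k → swapIdx k p ≡ p
swapIdx-other {suc (suc n)} zero F.zero             p≢k _     = ⊥-elim (p≢k refl)
swapIdx-other {suc (suc n)} zero (F.suc F.zero)     _   p≢k+1 = ⊥-elim (p≢k+1 refl)
swapIdx-other {suc (suc n)} zero (F.suc (F.suc p))  _   _     = refl
swapIdx-other {suc zero}    zero F.zero             _   _     = refl
swapIdx-other (suc k) F.zero    _ _ = refl
swapIdx-other (suc k) (F.suc p) p≢k p≢k+1 =
  cong F.suc (swapIdx-other k p (p≢k ∘ cong suc) (p≢k+1 ∘ cong suc))

lookup-ext : ∀ {A : Set} (xs ys : Vec A n) → (∀ i → lookup xs i ≡ lookup ys i) → xs ≡ ys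
lookup-ext xs ys eq = begin
  xs                    ≡⟨ VP.tabulate∘lookup xs ⟨
  V.tabulate (lookup xs) ≡⟨ VP.tabulate-cong eq ⟩
  V.tabulate (lookup ys) ≡⟨ VP.tabulate∘lookup ys ⟩
  ys                    ∎
  where open ≡-Reasoning

swapAdj-involutive : ∀ {A : Set} k (xs : Vec A n) → swapAdj k (swapAdj k xs) ≡ xs
swapAdj-involutive k xs = lookup-ext _ _ λ p → begin
  lookup (swapAdj k (swapAdj k xs)) p     ≡⟨ lookup-swapAdj k _ p ⟩
  lookup (swapAdj k xs) (swapIdx k p)     ≡⟨ lookup-swapAdj k xs _ ⟩
  lookup xs (swapIdx k (swapIdx k p))     ≡⟨ cong (lookup xs) (swapIdx-involutive k p) ⟩
  lookup xs p                             ∎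
  where open ≡-Reasoning

τ-left τ-right : ∀ j → ValidGen n j → Fin n
τ-left  (suc k) (_ , k+1<n) = fromℕ< (ℕP.<-trans (ℕP.n<1+n k) k+1<n)
τ-right (suc k) (_ , k+1<n) = fromℕ< k+1<n

toℕ-τ-left : ∀ k (v : ValidGen n (suc k)) → toℕ (τ-left (suc k) v) ≡ k
toℕ-τ-left k _ = FP.toℕ-fromℕ< _

toℕ-τ-right : ∀ k (v : ValidGen n (suc k)) → toℕ (τ-right (suc k) v) ≡ suc k
toℕ-τ-right k _ = FP.toℕ-fromℕ< _

τ-left<τ-right : ∀ j (v : ValidGen n j) → τ-left j v F.< τ-right j v
τ-left<τ-right (suc k) v rewrite toℕ-τ-left k v | toℕ-τ-right k v = ℕP.n<1+n k

adjacent⇒τ : ∀ (x y : Fin n) → toℕ y ≡ suc (toℕ x) →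
  Σ (ValidGen n (suc (toℕ x))) λ v → τ-left _ v ≡ x × τ-right _ v ≡ y
adjacent⇒τ {n} x y y≡x+1 = v , FP.toℕ-injective (toℕ-τ-left _ v) ,
                                FP.toℕ-injective (trans (toℕ-τ-right _ v) (sym y≡x+1))
  where
  v : ValidGen n (suc (toℕ x))
  v = s≤s z≤n , subst (ℕ._< n) y≡x+1 (FP.toℕ<n y)

lookup-·τ : ∀ (w : Word n) j p → lookup (w ·τ j) p ≡ lookup w (swapIdx (j ∸ 1) p)
lookup-·τ w j = lookup-swapAdj (j ∸ 1) w

swapIdx-τ-left : ∀ k (v : ValidGen n (suc k)) → swapIdx k (τ-left (suc k) v) ≡ τ-right (suc k) v
swapIdx-τ-left k v = FP.toℕ-injective (begin
  toℕ (swapIdx k (τ-left (suc k) v)) ≡⟨ toℕ-swapIdx-left k _ (toℕ-τ-left k v) (proj₂ v) ⟩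
  suc k                              ≡⟨ toℕ-τ-right k v ⟨
  toℕ (τ-right (suc k) v)            ∎)
  where open ≡-Reasoning

swapIdx-τ-right : ∀ k (v : ValidGen n (suc k)) → swapIdx k (τ-right (suc k) v) ≡ τ-left (suc k) v
swapIdx-τ-right k v = FP.toℕ-injective (trans (toℕ-swapIdx-right k _ (toℕ-τ-right k v)) (sym (toℕ-τ-left k v)))

lookup-·τ-left : ∀ (w : Word n) j (v : ValidGen n j) → lookup (w ·τ j) (τ-left j v) ≡ lookup w (τ-right j v)
lookup-·τ-left w (suc k) v = trans (lookup-·τ w (suc k) _) (cong (lookup w) (swapIdx-τ-left k v))

lookup-·τ-right : ∀ (w : Word n) j (v : ValidGen n j) → lookup (w ·τ j) (τ-right j v) ≡ lookup w (τ-left j v)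
lookup-·τ-right w (suc k) v = trans (lookup-·τ w (suc k) _) (cong (lookup w) (swapIdx-τ-right k v))

IsPerm-·τ : ∀ (w : Word n) j → IsPerm w → IsPerm (w ·τ j)
IsPerm-·τ w j w-inj p q eq = begin
  p                                   ≡⟨ swapIdx-involutive (j ∸ 1) p ⟨
  swapIdx (j ∸ 1) (swapIdx (j ∸ 1) p) ≡⟨ cong (swapIdx (j ∸ 1)) (w-inj _ _ w-swapped) ⟩
  swapIdx (j ∸ 1) (swapIdx (j ∸ 1) q) ≡⟨ swapIdx-involutive (j ∸ 1) q ⟩
  q                                   ∎
  where
  open ≡-Reasoning
  w-swapped : lookup w (swapIdx (j ∸ 1) p) ≡ lookup w (swapIdx (j ∸ 1) q)
  w-swapped = trans (sym (lookup-·τ w j p)) (trans eq (lookup-·τ w j q))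

swapIdx-below-cut : ∀ j c (v : ValidGen n j) → j ≢ c → (p : Fin n) → toℕ p ℕ.< c → toℕ (swapIdx (j ∸ 1) p) ℕ.< c
swapIdx-below-cut (suc k) c v j≢c p p<c with toℕ p ℕ.≟ k | toℕ p ℕ.≟ suc k
... | yes p≡k | _ = subst (ℕ._< c) (sym (toℕ-swapIdx-left k p p≡k (proj₂ v)))
                          (ℕP.≤∧≢⇒< (subst (ℕ._< c) p≡k p<c) j≢c)
... | no _ | yes p≡k+1 = subst (ℕ._< c) (sym (toℕ-swapIdx-right k p p≡k+1))
                               (ℕP.<-trans (ℕP.n<1+n k) (subst (ℕ._< c) p≡k+1 p<c))
... | no p≢k | no p≢k+1 = subst (λ q → toℕ q ℕ.< c) (sym (swapIdx-other k p p≢k p≢k+1)) p<c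

swapIdx-above-cut : ∀ j c (v : ValidGen n j) → j ≢ c → (p : Fin n) → c ℕ.≤ toℕ p → c ℕ.≤ toℕ (swapIdx (j ∸ 1) p)
swapIdx-above-cut (suc k) c v j≢c p c≤p with toℕ p ℕ.≟ k | toℕ p ℕ.≟ suc k
... | yes p≡k | _ = subst (c ℕ.≤_) (sym (toℕ-swapIdx-left k p p≡k (proj₂ v)))
                          (ℕP.m≤n⇒m≤1+n (subst (c ℕ.≤_) p≡k c≤p))
... | no _ | yes p≡k+1 = subst (c ℕ.≤_) (sym (toℕ-swapIdx-right k p p≡k+1))
                               (ℕP.≤-pred (ℕP.≤∧≢⇒< (subst (c ℕ.≤_) p≡k+1 c≤p) (j≢c ∘ sym)))
... | no p≢k | no p≢k+1 = subst (λ q → c ℕ.≤ toℕ q) (sym (swapIdx-other k p p≢k p≢k+1)) c≤p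

-- Counting inversions

indicator : ∀ {P : Set} → Dec P → ℕ
indicator (yes _) = 1
indicator (no _)  = 0

indicator-yes : ∀ {P : Set} (P? : Dec P) → P → indicator P? ≡ 1
indicator-yes (yes _) _  = refl
indicator-yes (no ¬p) p  = ⊥-elim (¬p p)

indicator-no : ∀ {P : Set} (P? : Dec P) → ¬ P → indicator P? ≡ 0
indicator-no (yes p) ¬p = ⊥-elim (¬p p)
indicator-no (no _)  _  = refl

indicator≤1 : ∀ {P : Set} (P? : Dec P) → indicator P? ℕ.≤ 1
indicator≤1 (yes _) = ℕP.≤-refl
indicator≤1 (no _)  = z≤n

indicator-cong : ∀ {P Q : Set} (P? : Dec P) (Q? : Dec Q) → (P → Q) → (Q → P) → indicator P? ≡ indicator Q?
indicator-cong (yes _) (yes _) _ _ = refl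
indicator-cong (yes p) (no ¬q) f _ = ⊥-elim (¬q (f p))
indicator-cong (no ¬p) (yes q) _ g = ⊥-elim (¬p (g q))
indicator-cong (no _)  (no _)  _ _ = refl

countFin : {P : Pred (Fin n) 0ℓ} → Decidable P → ℕ
countFin {zero}  _  = 0
countFin {suc n} P? = indicator (P? F.zero) + countFin (P? ∘ F.suc)

countFin-cong : {P Q : Pred (Fin n) 0ℓ} (P? : Decidable P) (Q? : Decidable Q) →
  (∀ i → P i → Q i) → (∀ i → Q i → P i) → countFin P? ≡ countFin Q?
countFin-cong {zero}  _  _  _ _ = refl
countFin-cong {suc n} P? Q? f g = cong₂ _+_ (indicator-cong (P? F.zero) (Q? F.zero) (f F.zero) (g F.zero))
                                            (countFin-cong (P? ∘ F.suc) (Q? ∘ F.suc) (f ∘ F.suc) (g ∘ F.suc))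

sumFin : (Fin n → ℕ) → ℕ
sumFin {zero}  _ = 0
sumFin {suc n} h = h F.zero + sumFin (h ∘ F.suc)

sumFin-cong : (g h : Fin n → ℕ) → (∀ i → g i ≡ h i) → sumFin g ≡ sumFin h
sumFin-cong {zero}  _ _ _  = refl
sumFin-cong {suc n} g h eq = cong₂ _+_ (eq F.zero) (sumFin-cong _ _ (eq ∘ F.suc))

module _ {A : Set} {P : Pred A 0ℓ} (P? : Decidable P) where

  length-filter-++ : (xs ys : List A) →
    length (filter P? (xs L.++ ys)) ≡ length (filter P? xs) + length (filter P? ys)
  length-filter-++ xs ys = trans (cong length (LP.filter-++ P? xs ys)) (LP.length-++ (filter P? xs))

  length-filter-tabulate : (f : Fin n → A) → length (filter P? (tabulate f)) ≡ countFin (P? ∘ f)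
  length-filter-tabulate {zero}  f = refl
  length-filter-tabulate {suc n} f with P? (f F.zero)
  ... | yes _ = cong suc (length-filter-tabulate (f ∘ F.suc))
  ... | no _  = length-filter-tabulate (f ∘ F.suc)

length-filter-map : ∀ {A B : Set} {P : Pred B 0ℓ} (P? : Decidable P) (f : A → B) (xs : List A) →
  length (filter P? (L.map f xs)) ≡ length (filter (P? ∘ f) xs)
length-filter-map P? f L.[] = refl
length-filter-map P? f (x L.∷ xs) with P? (f x)
... | yes _ = cong suc (length-filter-map P? f xs)
... | no _  = length-filter-map P? f xs

length-filter-cartesianProduct : ∀ {A B : Set} {P : Pred (A × B) 0ℓ} (P? : Decidable P) (f : Fin n → A) (ys : List B) →
  length (filter P? (cartesianProduct (tabulate f) ys)) ≡ sumFin (λ i → length (filter (λ y → P? (f i , y)) ys))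
length-filter-cartesianProduct {zero}  P? f ys = refl
length-filter-cartesianProduct {suc n} P? f ys =
  trans (length-filter-++ P? (L.map (f F.zero ,_) ys) _)
        (cong₂ _+_ (length-filter-map P? (f F.zero ,_) ys) (length-filter-cartesianProduct P? (f ∘ F.suc) ys))

entriesBelow : Fin m → Vec (Fin m) n → ℕ
entriesBelow x []       = 0
entriesBelow x (y ∷ ys) = indicator (y F.<? x) + entriesBelow x ys

inversions : Vec (Fin m) n → ℕ
inversions []       = 0
inversions (y ∷ ys) = entriesBelow y ys + inversions ys

IsInversion : Vec (Fin m) n → Pred (Fin n × Fin n) 0ℓ
IsInversion v (i , j) = i F.< j × lookup v j F.< lookup v i

isInversion? : (v : Vec (Fin m) n) → Decidable (IsInversion v)
isInversion? v (i , j) = (i F.<? j) ×-dec (lookup v j F.<? lookup v i)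

inversionsByRow : Vec (Fin m) n → ℕ
inversionsByRow v = sumFin λ i → countFin λ j → isInversion? v (i , j)

ℓ≡inversionsByRow : (w : Word n) → ℓ w ≡ inversionsByRow w
ℓ≡inversionsByRow {n} w =
  trans (length-filter-cartesianProduct (isInversion? w) (λ i → i) (L.allFin n))
        (sumFin-cong _ _ λ i → length-filter-tabulate (λ j → isInversion? w (i , j)) (λ j → j))

entriesBelow≡countFin : (x : Fin m) (v : Vec (Fin m) n) → entriesBelow x v ≡ countFin (λ j → lookup v j F.<? x)
entriesBelow≡countFin x []       = refl
entriesBelow≡countFin x (y ∷ ys) = cong (indicator (y F.<? x) +_) (entriesBelow≡countFin x ys)

inversionsByRow≡inversions : (v : Vec (Fin m) n) → inversionsByRow v ≡ inversions v
inversionsByRow≡inversions [] = refl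
inversionsByRow≡inversions (x ∷ xs) = cong₂ _+_ firstRow (trans otherRows (inversionsByRow≡inversions xs))
  where
  v = x ∷ xs
  firstRow : countFin (λ j → isInversion? v (F.zero , j)) ≡ entriesBelow x xs
  firstRow = begin
    indicator (isInversion? v (F.zero , F.zero)) + countFin (λ j → isInversion? v (F.zero , F.suc j))
      ≡⟨ cong (_+ countFin (λ j → isInversion? v (F.zero , F.suc j)))
              (indicator-no (isInversion? v (F.zero , F.zero)) λ ()) ⟩
    countFin (λ j → isInversion? v (F.zero , F.suc j))
      ≡⟨ countFin-cong _ (λ j → lookup xs j F.<? x) (λ _ → proj₂) (λ _ lt → s≤s z≤n , lt) ⟩
    countFin (λ j → lookup xs j F.<? x)
      ≡⟨ entriesBelow≡countFin x xs ⟨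
    entriesBelow x xs ∎
    where open ≡-Reasoning
  otherRow : ∀ i → countFin (λ j → isInversion? v (F.suc i , j)) ≡ countFin (λ j → isInversion? xs (i , j))
  otherRow i = trans (cong (_+ countFin (λ j → isInversion? v (F.suc i , F.suc j)))
                           (indicator-no (isInversion? v (F.suc i , F.zero)) λ ()))
                     (countFin-cong (λ j → isInversion? v (F.suc i , F.suc j)) (λ j → isInversion? xs (i , j))
                                    (λ _ (lt , gt) → ℕP.≤-pred lt , gt) (λ _ (lt , gt) → s≤s lt , gt))
  otherRows : sumFin (λ i → countFin (λ j → isInversion? v (F.suc i , j))) ≡ inversionsByRow xs
  otherRows = sumFin-cong _ _ otherRow

ℓ≡inversions : (w : Word n) → ℓ w ≡ inversions w
ℓ≡inversions w = trans (ℓ≡inversionsByRow w) (inversionsByRow≡inversions w)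

entriesBelow-swapAdj : ∀ (x : Fin m) k (v : Vec (Fin m) n) → entriesBelow x (swapAdj k v) ≡ entriesBelow x v
entriesBelow-swapAdj x zero    []           = refl
entriesBelow-swapAdj x zero    (a ∷ [])     = refl
entriesBelow-swapAdj x zero    (a ∷ b ∷ xs) = x∙yz≈y∙xz (indicator (b F.<? x)) (indicator (a F.<? x)) (entriesBelow x xs)
entriesBelow-swapAdj x (suc k) []           = refl
entriesBelow-swapAdj x (suc k) (a ∷ xs)     = cong (indicator (a F.<? x) +_) (entriesBelow-swapAdj x k xs)

-- Swapping the entries at positions k, k + 1 only changes whether that pair is an inversion; both
-- sides are written without subtraction.
inversions-swapAdj : ∀ k (v : Vec (Fin m) n) (a b : Fin n) → toℕ a ≡ k → toℕ b ≡ suc k →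
  inversions (swapAdj k v) + indicator (lookup v b F.<? lookup v a) ≡ inversions v + indicator (lookup v a F.<? lookup v b)
inversions-swapAdj zero (x ∷ y ∷ xs) F.zero (F.suc F.zero) _ _ =
  rearrange (indicator (x F.<? y)) (indicator (y F.<? x)) (entriesBelow y xs) (entriesBelow x xs) (inversions xs)
  where
  rearrange : ∀ p q r s t → (p + r + (s + t)) + q ≡ (q + s + (r + t)) + p
  rearrange = solve-∀
inversions-swapAdj (suc k) (x ∷ xs) (F.suc a) (F.suc b) a≡k+1 b≡k+2 = begin
  entriesBelow x (swapAdj k xs) + inversions (swapAdj k xs) + [b<a]
    ≡⟨ cong (λ e → e + inversions (swapAdj k xs) + [b<a]) (entriesBelow-swapAdj x k xs) ⟩
  entriesBelow x xs + inversions (swapAdj k xs) + [b<a]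
    ≡⟨ ℕP.+-assoc (entriesBelow x xs) _ [b<a] ⟩
  entriesBelow x xs + (inversions (swapAdj k xs) + [b<a])
    ≡⟨ cong (entriesBelow x xs +_) (inversions-swapAdj k xs a b (ℕP.suc-injective a≡k+1) (ℕP.suc-injective b≡k+2)) ⟩
  entriesBelow x xs + (inversions xs + [a<b])
    ≡⟨ ℕP.+-assoc (entriesBelow x xs) _ [a<b] ⟨
  entriesBelow x xs + inversions xs + [a<b] ∎
  where
  open ≡-Reasoning
  [b<a] = indicator (lookup xs b F.<? lookup xs a)
  [a<b] = indicator (lookup xs a F.<? lookup xs b)

module _ (w : Word n) where

  ℓ-·τ : ∀ j (v : ValidGen n j) →
    ℓ (w ·τ j) + indicator (lookup w (τ-right j v) F.<? lookup w (τ-left j v))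
      ≡ ℓ w + indicator (lookup w (τ-left j v) F.<? lookup w (τ-right j v))
  ℓ-·τ (suc k) v = begin
    ℓ (w ·τ suc k) + [r<l]          ≡⟨ cong (_+ [r<l]) (ℓ≡inversions (w ·τ suc k)) ⟩
    inversions (w ·τ suc k) + [r<l] ≡⟨ inversions-swapAdj k w _ _ (toℕ-τ-left k v) (toℕ-τ-right k v) ⟩
    inversions w + [l<r]            ≡⟨ cong (_+ [l<r]) (ℓ≡inversions w) ⟨
    ℓ w + [l<r]                     ∎
    where
    open ≡-Reasoning
    [r<l] = indicator (lookup w (τ-right (suc k) v) F.<? lookup w (τ-left (suc k) v))
    [l<r] = indicator (lookup w (τ-left (suc k) v) F.<? lookup w (τ-right (suc k) v))

  module _ j (v : ValidGen n j) where

    private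
      l = lookup w (τ-left j v)
      r = lookup w (τ-right j v)

    ℓ-·τ-ascent : l F.< r → ℓ (w ·τ j) ≡ suc (ℓ w)
    ℓ-·τ-ascent l<r = begin
      ℓ (w ·τ j)                           ≡⟨ ℕP.+-identityʳ _ ⟨
      ℓ (w ·τ j) + 0                       ≡⟨ cong (ℓ (w ·τ j) +_) (indicator-no (r F.<? l) (ℕP.<-asym l<r)) ⟨
      ℓ (w ·τ j) + indicator (r F.<? l)    ≡⟨ ℓ-·τ j v ⟩
      ℓ w + indicator (l F.<? r)           ≡⟨ cong (ℓ w +_) (indicator-yes (l F.<? r) l<r) ⟩
      ℓ w + 1                              ≡⟨ ℕP.+-comm (ℓ w) 1 ⟩
      suc (ℓ w)                            ∎
      where open ≡-Reasoning

    ℓ-·τ-descent : r F.< l → ℓ w ≡ suc (ℓ (w ·τ j))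
    ℓ-·τ-descent r<l = begin
      ℓ w                                  ≡⟨ ℕP.+-identityʳ _ ⟨
      ℓ w + 0                              ≡⟨ cong (ℓ w +_) (indicator-no (l F.<? r) (ℕP.<-asym r<l)) ⟨
      ℓ w + indicator (l F.<? r)           ≡⟨ ℓ-·τ j v ⟨
      ℓ (w ·τ j) + indicator (r F.<? l)    ≡⟨ cong (ℓ (w ·τ j) +_) (indicator-yes (r F.<? l) r<l) ⟩
      ℓ (w ·τ j) + 1                       ≡⟨ ℕP.+-comm (ℓ (w ·τ j)) 1 ⟩
      suc (ℓ (w ·τ j))                     ∎
      where open ≡-Reasoning

    ℓ-·τ-≤ : ℓ (w ·τ j) ℕ.≤ suc (ℓ w)
    ℓ-·τ-≤ = begin
      ℓ (w ·τ j)                           ≤⟨ ℕP.m≤m+n _ _ ⟩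
      ℓ (w ·τ j) + indicator (r F.<? l)    ≡⟨ ℓ-·τ j v ⟩
      ℓ w + indicator (l F.<? r)           ≤⟨ ℕP.+-monoʳ-≤ (ℓ w) (indicator≤1 (l F.<? r)) ⟩
      ℓ w + 1                              ≡⟨ ℕP.+-comm (ℓ w) 1 ⟩
      suc (ℓ w)                            ∎
      where open ℕP.≤-Reasoning

    ℓ-·τ-increase⇒ascent : ℓ w ℕ.< ℓ (w ·τ j) → l F.< r
    ℓ-·τ-increase⇒ascent longer with l F.<? r
    ... | yes l<r = l<r
    ... | no l≮r  = ⊥-elim (ℕP.<-irrefl refl (ℕP.<-≤-trans longer (begin
      ℓ (w ·τ j)                           ≤⟨ ℕP.m≤m+n _ _ ⟩
      ℓ (w ·τ j) + indicator (r F.<? l)    ≡⟨ ℓ-·τ j v ⟩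
      ℓ w + indicator (l F.<? r)           ≡⟨ cong (ℓ w +_) (indicator-no (l F.<? r) l≮r) ⟩
      ℓ w + 0                              ≡⟨ ℕP.+-identityʳ _ ⟩
      ℓ w                                  ∎)))
      where open ℕP.≤-Reasoning

AscendsBetween : (Fin n → Fin m) → Fin n → Fin n → Set
AscendsBetween f a b = ∀ {x y} → a F.≤ x → toℕ y ≡ suc (toℕ x) → y F.≤ b → f x F.< f y

ascending-run : ∀ {n m} (f : Fin n → Fin m) {a b : Fin n} → AscendsBetween f a b →
  ∀ d → toℕ b ≡ toℕ a + d → toℕ (f a) + d ℕ.≤ toℕ (f b)
ascending-run f {a} {b} _ zero b≡a+0 =
  subst (λ c → toℕ (f a) + 0 ℕ.≤ toℕ (f c)) a≡b (ℕP.≤-reflexive (ℕP.+-identityʳ _))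
  where
  a≡b : a ≡ b
  a≡b = FP.toℕ-injective (trans (sym (ℕP.+-identityʳ (toℕ a))) (sym b≡a+0))
ascending-run {n} f {a} {b} ascends (suc d) b≡a+d+1 = begin
  toℕ (f a) + suc d   ≡⟨ ℕP.+-suc (toℕ (f a)) d ⟩
  suc (toℕ (f a) + d) ≤⟨ s≤s (ascending-run f ascendsUpToPrev d toℕ-prev) ⟩
  suc (toℕ (f prev))  ≤⟨ ascends (ℕP.≤-trans (ℕP.m≤m+n (toℕ a) d) (ℕP.≤-reflexive (sym toℕ-prev))) b≡prev+1 ℕP.≤-refl ⟩
  toℕ (f b)           ∎
  where
  open ℕP.≤-Reasoning
  prev<n : toℕ a + d ℕ.< n
  prev<n = ℕP.<-≤-trans (ℕP.+-monoʳ-< (toℕ a) (ℕP.n<1+n d))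
                        (ℕP.≤-trans (ℕP.≤-reflexive (sym b≡a+d+1)) (ℕP.<⇒≤ (FP.toℕ<n b)))
  prev : Fin n
  prev = fromℕ< prev<n
  toℕ-prev : toℕ prev ≡ toℕ a + d
  toℕ-prev = FP.toℕ-fromℕ< prev<n
  b≡prev+1 : toℕ b ≡ suc (toℕ prev)
  b≡prev+1 = trans b≡a+d+1 (trans (ℕP.+-suc (toℕ a) d) (cong suc (sym toℕ-prev)))
  ascendsUpToPrev : AscendsBetween f a prev
  ascendsUpToPrev a≤x y≡x+1 y≤prev =
    ascends a≤x y≡x+1 (ℕP.≤-trans y≤prev (ℕP.≤-trans (ℕP.n≤1+n _) (ℕP.≤-reflexive (sym b≡prev+1))))

AscendsBetween⇒< : ∀ {n m} (f : Fin n → Fin m) {a b : Fin n} → AscendsBetween f a b → a F.< b → f a F.< f b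
AscendsBetween⇒< f {a} {b} ascends a<b = begin-strict
  toℕ (f a)                         <⟨ ℕP.m<m+n (toℕ (f a)) (ℕP.m<n⇒0<n∸m a<b) ⟩
  toℕ (f a) + (toℕ b ∸ toℕ a)        ≤⟨ ascending-run f ascends _ (sym (ℕP.m+[n∸m]≡n (ℕP.<⇒≤ a<b))) ⟩
  toℕ (f b)                         ∎
  where open ℕP.≤-Reasoning

-- Reduced expressions

lookup-idW : (p : Fin n) → lookup (idW {n}) p ≡ p
lookup-idW = VP.lookup-allFin

ℓ-idW : ℓ (idW {n}) ≡ 0
ℓ-idW {n} =
  cong length (LP.filter-none (isInversion? idW) (All.universal noInversion (cartesianProduct (L.allFin n) (L.allFin n))))
  where
  noInversion : ∀ ij → ¬ IsInversion idW ij
  noInversion (i , j) (i<j , j<i) = ℕP.<-asym i<j (subst₂ F._<_ (lookup-idW j) (lookup-idW i) j<i)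

increasing⇒idW : (w : Word n) → (∀ {a b} → a F.< b → lookup w a F.< lookup w b) → w ≡ idW
increasing⇒idW {zero}   []  _          = refl
increasing⇒idW {suc n′} w   increasing =
  lookup-ext w idW λ p → trans (FP.toℕ-injective (ℕP.≤-antisym (atMost p) (atLeast p))) (sym (lookup-idW p))
  where
  ascends : ∀ {a b} → AscendsBetween (lookup w) a b
  ascends {x = x} _ y≡x+1 _ = increasing (subst (toℕ x ℕ.<_) (sym y≡x+1) (ℕP.n<1+n (toℕ x)))
  atLeast : ∀ p → toℕ p ℕ.≤ toℕ (lookup w p)
  atLeast p = ℕP.≤-trans (ℕP.m≤n+m (toℕ p) _) (ascending-run (lookup w) {F.zero} ascends (toℕ p) refl)
  atMost : ∀ p → toℕ (lookup w p) ℕ.≤ toℕ p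
  atMost p = ℕP.+-cancelʳ-≤ d _ _ (begin
    toℕ (lookup w p) + d          ≤⟨ ascending-run (lookup w) ascends d last≡p+d ⟩
    toℕ (lookup w (F.fromℕ n′))   ≤⟨ FP.toℕ≤pred[n] _ ⟩
    n′                            ≡⟨ p+d≡n′ ⟨
    toℕ p + d                     ∎)
    where
    open ℕP.≤-Reasoning
    d = n′ ∸ toℕ p
    p+d≡n′ : toℕ p + d ≡ n′
    p+d≡n′ = ℕP.m+[n∸m]≡n (FP.toℕ≤pred[n] p)
    last≡p+d : toℕ (F.fromℕ n′) ≡ toℕ p + d
    last≡p+d = trans (FP.toℕ-fromℕ n′) (sym p+d≡n′)

descentOrIncreasing : (w : Word n) → IsPerm w →
  (∃₂ λ j (v : ValidGen n j) → lookup w (τ-right j v) F.< lookup w (τ-left j v)) ⊎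
  (∀ {a b} → a F.< b → lookup w a F.< lookup w b)
descentOrIncreasing w w-inj
  with FP.any? (λ x → FP.any? (λ y → (toℕ y ℕ.≟ suc (toℕ x)) ×-dec (lookup w y F.<? lookup w x)))
... | yes (x , y , y≡x+1 , wy<wx) with adjacent⇒τ x y y≡x+1
...   | v , left≡x , right≡y =
  inj₁ (_ , v , subst₂ (λ r l → lookup w r F.< lookup w l) (sym right≡y) (sym left≡x) wy<wx)
descentOrIncreasing w w-inj | no noDescent = inj₂ (AscendsBetween⇒< (lookup w) ascends)
  where
  ascends : ∀ {a b} → AscendsBetween (lookup w) a b
  ascends {x = x} {y} _ y≡x+1 _ =
    ℕP.≤∧≢⇒< (ℕP.≮⇒≥ λ wy<wx → noDescent (x , y , y≡x+1 , wy<wx))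
             λ wx≡wy → ℕP.1+n≢n (sym (trans (cong toℕ (w-inj x y (FP.toℕ-injective wx≡wy))) y≡x+1))

reducedExpr-·τ-descent : ∀ (w : Word n) j (v : ValidGen n j) → lookup w (τ-right j v) F.< lookup w (τ-left j v) →
  ∃ (IsReducedExpr (w ·τ j)) → ∃ (IsReducedExpr w)
reducedExpr-·τ-descent w j v descent (ws , valid , eval , len) =
  ws L.++ L.[ j ] , AllP.++⁺ valid (v All.∷ All.[]) , eval-snoc , length-snoc
  where
  open ≡-Reasoning
  eval-snoc : evalGens (ws L.++ L.[ j ]) ≡ w
  eval-snoc = begin
    evalGens (ws L.++ L.[ j ]) ≡⟨ LP.foldl-++ _·τ_ idW ws L.[ j ] ⟩
    evalGens ws ·τ j           ≡⟨ cong (_·τ j) eval ⟩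
    (w ·τ j) ·τ j              ≡⟨ swapAdj-involutive (j ∸ 1) w ⟩
    w                          ∎
  length-snoc : length (ws L.++ L.[ j ]) ≡ ℓ w
  length-snoc = begin
    length (ws L.++ L.[ j ]) ≡⟨ LP.length-++ ws ⟩
    length ws + 1            ≡⟨ ℕP.+-comm (length ws) 1 ⟩
    suc (length ws)          ≡⟨ cong suc len ⟩
    suc (ℓ (w ·τ j))         ≡⟨ ℓ-·τ-descent w j v descent ⟨
    ℓ w                      ∎

reducedExpr : (w : Word n) → IsPerm w → ∃ (IsReducedExpr w)
reducedExpr {n} w w-inj = byLength (ℓ w) w w-inj refl
  where
  byLength : ∀ k (w : Word n) → IsPerm w → ℓ w ≡ k → ∃ (IsReducedExpr w)
  byLength k w w-inj ℓw≡k with descentOrIncreasing w w-inj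
  ... | inj₂ increasing =
    L.[] , subst (λ x → IsReducedExpr x L.[]) (sym (increasing⇒idW w increasing)) (All.[] , refl , sym (ℓ-idW {n}))
  byLength zero w _ ℓw≡0 | inj₁ (j , v , descent) =
    ⊥-elim (ℕP.1+n≢0 (trans (sym (ℓ-·τ-descent w j v descent)) ℓw≡0))
  byLength (suc k) w w-inj ℓw≡k+1 | inj₁ (j , v , descent) =
    reducedExpr-·τ-descent w j v descent
      (byLength k (w ·τ j) (IsPerm-·τ w j w-inj) (ℕP.suc-injective (trans (sym (ℓ-·τ-descent w j v descent)) ℓw≡k+1)))

-- Cuts

Crossing : ℕ → Word n → Set
Crossing {n} c w = ∃₂ λ (p q : Fin n) → toℕ p ℕ.< c × c ℕ.≤ toℕ q × lookup w q F.< lookup w p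

PreservesCut : ℕ → Word n → Set
PreservesCut {n} c w = ∀ (p : Fin n) →
  (toℕ p ℕ.< c → toℕ (lookup w p) ℕ.< c) × (c ℕ.≤ toℕ p → c ℕ.≤ toℕ (lookup w p))

MovesAcross : ℕ → Word n → Set
MovesAcross {n} c w = ∃ λ (p : Fin n) →
  (toℕ p ℕ.< c × c ℕ.≤ toℕ (lookup w p)) ⊎ (toℕ (lookup w p) ℕ.< c × c ℕ.≤ toℕ p)

Crossing⇒MovesAcross : ∀ c (w : Word n) → Crossing c w → MovesAcross c w
Crossing⇒MovesAcross c w (p , q , p<c , c≤q , wq<wp) with c ℕ.≤? toℕ (lookup w p)
... | yes c≤wp = p , inj₁ (p<c , c≤wp)
... | no c≰wp  = q , inj₂ (ℕP.<-trans wq<wp (ℕP.≰⇒> c≰wp) , c≤q)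

¬MovesAcross-PreservesCut : ∀ c (w : Word n) → PreservesCut c w → ¬ MovesAcross c w
¬MovesAcross-PreservesCut c w preserves (p , inj₁ (p<c , c≤wp)) =
  ℕP.<-irrefl refl (ℕP.<-≤-trans (proj₁ (preserves p) p<c) c≤wp)
¬MovesAcross-PreservesCut c w preserves (p , inj₂ (wp<c , c≤p)) =
  ℕP.<-irrefl refl (ℕP.<-≤-trans wp<c (proj₂ (preserves p) c≤p))

module _ (w : Word n) j (v : ValidGen n j) where

  Crossing-·τ : ∀ c → j ≢ c → Crossing c w → Crossing c (w ·τ j)
  Crossing-·τ c j≢c (p , q , p<c , c≤q , wq<wp) =
    swapIdx (j ∸ 1) p , swapIdx (j ∸ 1) q ,
    swapIdx-below-cut j c v j≢c p p<c , swapIdx-above-cut j c v j≢c q c≤q ,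
    subst₂ F._<_ (sym (moved q)) (sym (moved p)) wq<wp
    where
    moved : ∀ r → lookup (w ·τ j) (swapIdx (j ∸ 1) r) ≡ lookup w r
    moved r = trans (lookup-·τ w j _) (cong (lookup w) (swapIdx-involutive (j ∸ 1) r))

  PreservesCut-·τ : ∀ c → j ≢ c → PreservesCut c w → PreservesCut c (w ·τ j)
  PreservesCut-·τ c j≢c preserves p =
    (λ p<c → subst (λ x → toℕ x ℕ.< c) (sym (lookup-·τ w j p))
                   (proj₁ (preserves _) (swapIdx-below-cut j c v j≢c p p<c))) ,
    (λ c≤p → subst (λ x → c ℕ.≤ toℕ x) (sym (lookup-·τ w j p))
                   (proj₂ (preserves _) (swapIdx-above-cut j c v j≢c p c≤p)))

Crossing-·τ-ascent : ∀ (w : Word n) j (v : ValidGen n j) →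
  lookup w (τ-left j v) F.< lookup w (τ-right j v) → Crossing j (w ·τ j)
Crossing-·τ-ascent w (suc k) v ascent =
  τ-left (suc k) v , τ-right (suc k) v ,
  subst (ℕ._< suc k) (sym (toℕ-τ-left k v)) (ℕP.n<1+n k) ,
  ℕP.≤-reflexive (sym (toℕ-τ-right k v)) ,
  subst₂ F._<_ (sym (lookup-·τ-right w (suc k) v)) (sym (lookup-·τ-left w (suc k) v)) ascent

PreservesCut-idW : ∀ c → PreservesCut c (idW {n})
PreservesCut-idW c p = (λ p<c → subst (λ x → toℕ x ℕ.< c) (sym (lookup-idW p)) p<c) ,
                       (λ c≤p → subst (λ x → c ℕ.≤ toℕ x) (sym (lookup-idW p)) c≤p)

_·τ*_ : Word n → List ℕ → Word n
z ·τ* ws = L.foldl _·τ_ z ws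

ℓ-·τ*-≤ : ∀ (z : Word n) ws → All (ValidGen n) ws → ℓ (z ·τ* ws) ℕ.≤ ℓ z + length ws
ℓ-·τ*-≤ z L.[]       _                 = ℕP.m≤m+n (ℓ z) 0
ℓ-·τ*-≤ z (j L.∷ ws) (v All.∷ valid) = begin
  ℓ ((z ·τ j) ·τ* ws)     ≤⟨ ℓ-·τ*-≤ (z ·τ j) ws valid ⟩
  ℓ (z ·τ j) + length ws  ≤⟨ ℕP.+-monoˡ-≤ (length ws) (ℓ-·τ-≤ z j v) ⟩
  suc (ℓ z) + length ws   ≡⟨ ℕP.+-suc (ℓ z) (length ws) ⟨
  ℓ z + length (j L.∷ ws) ∎
  where open ℕP.≤-Reasoning

firstLetter-ascends : ∀ (z : Word n) j ws → All (ValidGen n) (j L.∷ ws) →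
  ℓ (z ·τ* (j L.∷ ws)) ≡ ℓ z + length (j L.∷ ws) → ℓ (z ·τ j) ≡ suc (ℓ z)
firstLetter-ascends z j ws (v All.∷ valid) maximal =
  ℕP.≤-antisym (ℓ-·τ-≤ z j v) (ℕP.+-cancelʳ-≤ (length ws) _ _ (begin
    suc (ℓ z) + length ws    ≡⟨ ℕP.+-suc (ℓ z) (length ws) ⟨
    ℓ z + suc (length ws)    ≡⟨ maximal ⟨
    ℓ ((z ·τ j) ·τ* ws)      ≤⟨ ℓ-·τ*-≤ (z ·τ j) ws valid ⟩
    ℓ (z ·τ j) + length ws   ∎))
  where open ℕP.≤-Reasoning

Crossing-·τ* : ∀ c (z : Word n) ws → All (ValidGen n) ws → ℓ (z ·τ* ws) ≡ ℓ z + length ws →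
  Crossing c z ⊎ c ∈ ws → Crossing c (z ·τ* ws)
Crossing-·τ* c z L.[] _ _ (inj₁ crossing) = crossing
Crossing-·τ* c z (j L.∷ ws) valid@(v All.∷ valid′) maximal crossingOrLetter =
  Crossing-·τ* c (z ·τ j) ws valid′ maximal′ (step crossingOrLetter)
  where
  ascends : ℓ (z ·τ j) ≡ suc (ℓ z)
  ascends = firstLetter-ascends z j ws valid maximal
  maximal′ : ℓ ((z ·τ j) ·τ* ws) ≡ ℓ (z ·τ j) + length ws
  maximal′ = trans maximal (trans (ℕP.+-suc (ℓ z) (length ws)) (cong (_+ length ws) (sym ascends)))
  step : Crossing c z ⊎ c ∈ j L.∷ ws → Crossing c (z ·τ j) ⊎ c ∈ ws
  step h with j ℕ.≟ c
  step h | yes refl = inj₁ (Crossing-·τ-ascent z j v (ℓ-·τ-increase⇒ascent z j v (ℕP.≤-reflexive (sym ascends))))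
  step (inj₁ crossing)  | no j≢c = inj₁ (Crossing-·τ z j v c j≢c crossing)
  step (inj₂ (here c≡j)) | no j≢c = ⊥-elim (j≢c (sym c≡j))
  step (inj₂ (there c∈ws)) | no _ = inj₂ c∈ws

PreservesCut-·τ* : ∀ c (z : Word n) ws → All (ValidGen n) ws → ¬ c ∈ ws → PreservesCut c z → PreservesCut c (z ·τ* ws)
PreservesCut-·τ* c z L.[]       _                 _    preserves = preserves
PreservesCut-·τ* c z (j L.∷ ws) (v All.∷ valid) c∉ws preserves =
  PreservesCut-·τ* c (z ·τ j) ws valid (c∉ws ∘ there) (PreservesCut-·τ z j v c (c∉ws ∘ here ∘ sym) preserves)

Supp⇒Crossing : ∀ (w : Word n) c → Supp w c → Crossing c w
Supp⇒Crossing {n} w c (ws , (valid , eval , length≡ℓ) , c∈ws) =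
  subst (Crossing c) eval (Crossing-·τ* c idW ws valid maximal (inj₂ c∈ws))
  where
  maximal : ℓ (evalGens {n} ws) ≡ ℓ (idW {n}) + length ws
  maximal = trans (cong ℓ eval) (trans (sym length≡ℓ) (cong (_+ length ws) (sym (ℓ-idW {n}))))

MovesAcross⇒∈ : ∀ c ws → All (ValidGen n) ws → MovesAcross c (evalGens {n} ws) → c ∈ ws
MovesAcross⇒∈ {n} c ws valid moves with c ∈? ws
... | yes c∈ws = c∈ws
... | no c∉ws  = ⊥-elim (¬MovesAcross-PreservesCut c (evalGens ws)
                          (PreservesCut-·τ* c idW ws valid c∉ws (PreservesCut-idW {n} c)) moves)

MovesAcross⇒Supp : ∀ (w : Word n) c → IsPerm w → MovesAcross c w → Supp w c
MovesAcross⇒Supp w c w-inj moves with reducedExpr w w-inj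
... | ws , reduced@(valid , eval , _) = ws , reduced , MovesAcross⇒∈ c ws valid (subst (MovesAcross c) (sym eval) moves)

-- Blocks

module _ (T : GenSet) where

  SameBlock-sym : ∀ {a b : Fin n} → SameBlock T a b → SameBlock T b a
  SameBlock-sym same i Ti = proj₂ (same i Ti) , proj₁ (same i Ti)

  SameBlock-trans : ∀ {a b c : Fin n} → SameBlock T a b → SameBlock T b c → SameBlock T a c
  SameBlock-trans {a = a} {b} {c} ab bc i Ti = forward , backward
    where
    forward : ¬ (toℕ a ℕ.< i × i ℕ.≤ toℕ c)
    forward (a<i , i≤c) with i ℕ.≤? toℕ b
    ... | yes i≤b = proj₁ (ab i Ti) (a<i , i≤b)
    ... | no i≰b  = proj₁ (bc i Ti) (ℕP.≰⇒> i≰b , i≤c)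
    backward : ¬ (toℕ c ℕ.< i × i ℕ.≤ toℕ a)
    backward (c<i , i≤a) with i ℕ.≤? toℕ b
    ... | yes i≤b = proj₂ (bc i Ti) (c<i , i≤b)
    ... | no i≰b  = proj₂ (ab i Ti) (ℕP.≰⇒> i≰b , i≤a)

  τ-SameBlock : ∀ j (v : ValidGen n j) → ¬ T j → SameBlock T (τ-left j v) (τ-right j v)
  τ-SameBlock (suc k) v ¬Tj i Ti = separated , reversed
    where
    separated : ¬ (toℕ (τ-left (suc k) v) ℕ.< i × i ℕ.≤ toℕ (τ-right (suc k) v))
    separated (l<i , i≤r) = ¬Tj (subst T (ℕP.≤-antisym (subst (i ℕ.≤_) (toℕ-τ-right k v) i≤r)
                                                       (subst (ℕ._< i) (toℕ-τ-left k v) l<i)) Ti)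
    reversed : ¬ (toℕ (τ-right (suc k) v) ℕ.< i × i ℕ.≤ toℕ (τ-left (suc k) v))
    reversed (r<i , i≤l) = ℕP.<-irrefl refl (ℕP.<-≤-trans (subst (ℕ._< i) (toℕ-τ-right k v) r<i)
                                                          (ℕP.m≤n⇒m≤1+n (subst (i ℕ.≤_) (toℕ-τ-left k v) i≤l)))

  adjacent-¬cut : ∀ {a b x y : Fin n} → SameBlock T a b → a F.≤ x → toℕ y ≡ suc (toℕ x) → y F.≤ b → ¬ T (suc (toℕ x))
  adjacent-¬cut {y = y} same a≤x y≡x+1 y≤b Tx+1 = proj₁ (same _ Tx+1) (s≤s a≤x , subst (ℕ._≤ toℕ _) y≡x+1 y≤b)

  IncreasingOnBlocks : (Fin n → Fin m) → Set
  IncreasingOnBlocks f = ∀ {a b} → a F.< b → SameBlock T a b → f a F.< f b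

  ascentsOffCuts⇒IncreasingOnBlocks : (f : Fin n → Fin m) →
    (∀ j (v : ValidGen n j) → ¬ T j → f (τ-left j v) F.< f (τ-right j v)) → IncreasingOnBlocks f
  ascentsOffCuts⇒IncreasingOnBlocks f ascents a<b same = AscendsBetween⇒< f ascendsInside a<b
    where
    ascendsInside : AscendsBetween f _ _
    ascendsInside {x} {y} a≤x y≡x+1 y≤b with adjacent⇒τ x y y≡x+1
    ... | v , left≡x , right≡y = subst₂ (λ l r → f l F.< f r) left≡x right≡y
                                        (ascents _ v (adjacent-¬cut same a≤x y≡x+1 y≤b))

  IncreasingOnBlocks-reflects : ∀ (f : Fin n → Fin m) → IncreasingOnBlocks f →
    ∀ {a b} → SameBlock T a b → f a F.< f b → a F.< b
  IncreasingOnBlocks-reflects f increasing {a} {b} same fa<fb with FP.<-cmp a b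
  ... | tri< a<b _ _ = a<b
  ... | tri≈ _ refl _ = ⊥-elim (ℕP.<-irrefl refl fa<fb)
  ... | tri> _ _ b<a = ⊥-elim (ℕP.<-asym fa<fb (increasing b<a (SameBlock-sym same)))

  module _ {f : Fin n → Fin n} (staysInBlock : ∀ p → SameBlock T p (f p)) where

    SameBlock-map : ∀ {p q} → SameBlock T p q → SameBlock T (f p) (f q)
    SameBlock-map {p} {q} same =
      SameBlock-trans (SameBlock-sym (staysInBlock p)) (SameBlock-trans same (staysInBlock q))

    inversion-SameBlock : ∀ {p q} → p F.< q → f q F.< f p → SameBlock T p q
    inversion-SameBlock {p} {q} p<q fq<fp i Ti = separated , reversed
      where
      separated : ¬ (toℕ p ℕ.< i × i ℕ.≤ toℕ q)
      separated (p<i , i≤q) = ℕP.<-asym fq<fp (ℕP.<-≤-trans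
        (ℕP.≰⇒> λ i≤fp → proj₁ (staysInBlock p i Ti) (p<i , i≤fp))
        (ℕP.≮⇒≥ λ fq<i → proj₂ (staysInBlock q i Ti) (fq<i , i≤q)))
      reversed : ¬ (toℕ q ℕ.< i × i ℕ.≤ toℕ p)
      reversed (q<i , i≤p) = ℕP.<-asym p<q (ℕP.<-≤-trans q<i i≤p)

SameOrderOnBlocks : GenSet → Word n → Word n → Set
SameOrderOnBlocks {n} T w σ = ∀ (p q : Fin n) → p F.< q → SameBlock T p q →
  (lookup σ q F.< lookup σ p → lookup w q F.< lookup w p) × (lookup w q F.< lookup w p → lookup σ q F.< lookup σ p)

SameOrderOnBlocks-trans : ∀ (T : GenSet) {v u σ : Word n} →
  SameOrderOnBlocks T v σ → SameOrderOnBlocks T u σ → SameOrderOnBlocks T v u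
SameOrderOnBlocks-trans T vσ uσ p q p<q same =
  (λ uq<up → proj₁ (vσ p q p<q same) (proj₂ (uσ p q p<q same) uq<up)) ,
  (λ vq<vp → proj₁ (uσ p q p<q same) (proj₂ (vσ p q p<q same) vq<vp))

SameOrderOnBlocks⇒monotone : ∀ (T : GenSet) {v u : Word n} → IsPerm v → SameOrderOnBlocks T v u →
  ∀ {p q} → SameBlock T p q → lookup u p F.< lookup u q → lookup v p F.< lookup v q
SameOrderOnBlocks⇒monotone T {v} {u} v-inj sameOrder {p} {q} same up<uq with FP.<-cmp p q
... | tri< p<q _ _ = ℕP.≤∧≢⇒< (ℕP.≮⇒≥ λ vq<vp → ℕP.<-asym up<uq (proj₂ (sameOrder p q p<q same) vq<vp))
                              λ vp≡vq → FP.<⇒≢ p<q (v-inj p q (FP.toℕ-injective vp≡vq))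
... | tri≈ _ refl _ = ⊥-elim (ℕP.<-irrefl refl up<uq)
... | tri> _ _ q<p = proj₁ (sameOrder q p q<p (SameBlock-sym T same)) up<uq

-- The parabolic factorisation

IsPerm⇒surjective : (u : Word n) → IsPerm u → ∀ a → ∃ λ p → lookup u p ≡ a
IsPerm⇒surjective {n} u u-inj a with FP.any? (λ p → lookup u p FP.≟ a)
... | yes found = found
IsPerm⇒surjective {suc n} u u-inj a | no missed
  with FP.pigeonhole (ℕP.n<1+n n) (λ p → F.punchOut {i = a} {j = lookup u p} (missed ∘ (p ,_) ∘ sym))
... | i , j , i<j , collide =
  ⊥-elim (FP.<⇒≢ i<j (u-inj i j (FP.punchOut-injective (missed ∘ (i ,_) ∘ sym) (missed ∘ (j ,_) ∘ sym) collide)))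

lookup-· : ∀ (y x : Word n) p → lookup (y · x) p ≡ lookup y (lookup x p)
lookup-· y x p = VP.lookup-map p (lookup y) x

InParabolic-Supp : (u : Word n) → IsPerm u → InParabolic (Supp u) u
InParabolic-Supp u u-inj with reducedExpr u u-inj
... | ws , reduced@(valid , eval , _) = ws , valid , All.tabulate (λ j∈ws → ws , reduced , j∈ws) , eval

module _ (u : Word n) (u-inj : IsPerm u) where

  staysInBlock : ∀ p → SameBlock (Cw u) p (lookup u p)
  staysInBlock p i (_ , ¬supp) = (λ across → ¬supp (MovesAcross⇒Supp u i u-inj (p , inj₁ across))) ,
                                 (λ across → ¬supp (MovesAcross⇒Supp u i u-inj (p , inj₂ across)))

  IsStdT-self : IsStdT (Cw u) u u
  IsStdT-self = u-inj , staysInBlock , λ _ _ _ _ → (λ x → x) , (λ x → x)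

  ascentsOnSupport⇒IncreasingOnBlocks : (y : Word n) → (∀ i → ValidGen n i → Supp u i → ℓ y ℕ.< ℓ (y ·τ i)) →
    IncreasingOnBlocks (Cw u) (lookup y)
  ascentsOnSupport⇒IncreasingOnBlocks y ascends = ascentsOffCuts⇒IncreasingOnBlocks (Cw u) (lookup y) ascent
    where
    ascent : ∀ j (v : ValidGen n j) → ¬ Cw u j → lookup y (τ-left j v) F.< lookup y (τ-right j v)
    ascent j v ¬cut with lookup y (τ-left j v) F.<? lookup y (τ-right j v)
    ... | yes l<r = l<r
    ... | no l≮r  = ⊥-elim (¬cut (v , λ supp → l≮r (ℓ-·τ-increase⇒ascent y j v (ascends j v supp))))

  ≼⇒increasingFactor : ∀ {v : Word n} → u ≼ v →
    ∃ λ (y : Word n) → (∀ p → lookup v p ≡ lookup y (lookup u p)) × IncreasingOnBlocks (Cw u) (lookup y)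
  ≼⇒increasingFactor (_ , y , v≡y·u , ascends) =
    y , (λ p → trans (cong (λ x → lookup x p) v≡y·u) (lookup-· y u p)) ,
    ascentsOnSupport⇒IncreasingOnBlocks y ascends

  module _ (v : Word n) where

    ≼⇒IsStdT : u ≼ v → IsStdT (Cw u) v u
    ≼⇒IsStdT u≼v with ≼⇒increasingFactor u≼v
    ... | y , v≡y∘u , increasing = u-inj , staysInBlock , sameOrder
      where
      sameOrder : SameOrderOnBlocks (Cw u) v u
      sameOrder p q p<q same =
        (λ uq<up → subst₂ F._<_ (sym (v≡y∘u q)) (sym (v≡y∘u p)) (increasing uq<up sameImage)) ,
        (λ vq<vp → IncreasingOnBlocks-reflects (Cw u) (lookup y) increasing sameImage
                     (subst₂ F._<_ (v≡y∘u q) (v≡y∘u p) vq<vp))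
        where
        sameImage : SameBlock (Cw u) (lookup u q) (lookup u p)
        sameImage = SameBlock-map (Cw u) staysInBlock (SameBlock-sym (Cw u) same)

    ≼⇒Cw⊆Cw : IsPerm v → u ≼ v → Cw v ⊆G Cw u
    ≼⇒Cw⊆Cw v-inj u≼v i (valid , ¬suppV) with ≼⇒increasingFactor u≼v
    ... | y , v≡y∘u , increasing = valid , λ suppU → ¬suppV (MovesAcross⇒Supp v i v-inj
                                                              (Crossing⇒MovesAcross i v (crossing suppU)))
      where
      crossing : Supp u i → Crossing i v
      crossing suppU with Supp⇒Crossing u i suppU
      ... | p , q , p<i , i≤q , uq<up = p , q , p<i , i≤q ,
        subst₂ F._<_ (sym (v≡y∘u q)) (sym (v≡y∘u p)) (increasing uq<up (SameBlock-map (Cw u) staysInBlock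
          (SameBlock-sym (Cw u) (inversion-SameBlock (Cw u) staysInBlock (ℕP.<-≤-trans p<i i≤q) uq<up))))

    IsStdT⇒≼ : IsPerm v → IsStdT (Cw u) v u → u ≼ v
    IsStdT⇒≼ v-inj (_ , _ , sameOrder) = InParabolic-Supp u u-inj , y , v≡y·u , ascends
      where
      u⁻¹ : Word n
      u⁻¹ = V.tabulate (proj₁ ∘ IsPerm⇒surjective u u-inj)
      u∘u⁻¹ : ∀ a → lookup u (lookup u⁻¹ a) ≡ a
      u∘u⁻¹ a = trans (cong (lookup u) (VP.lookup∘tabulate _ a)) (proj₂ (IsPerm⇒surjective u u-inj a))
      y : Word n
      y = v · u⁻¹
      v≡y·u : v ≡ y · u
      v≡y·u = lookup-ext _ _ λ q → sym (begin
        lookup (y · u) q                  ≡⟨ lookup-· y u q ⟩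
        lookup y (lookup u q)             ≡⟨ lookup-· v u⁻¹ (lookup u q) ⟩
        lookup v (lookup u⁻¹ (lookup u q)) ≡⟨ cong (lookup v) (u-inj _ _ (u∘u⁻¹ (lookup u q))) ⟩
        lookup v q                        ∎)
        where open ≡-Reasoning
      ascends : ∀ j → ValidGen n j → Supp u j → ℓ y ℕ.< ℓ (y ·τ j)
      ascends j valid supp = ℕP.≤-reflexive (sym (ℓ-·τ-ascent y j valid ascent))
        where
        l = τ-left j valid
        r = τ-right j valid
        preimagesInBlock : SameBlock (Cw u) (lookup u⁻¹ l) (lookup u⁻¹ r)
        preimagesInBlock =
          SameBlock-trans (Cw u) (subst (SameBlock (Cw u) _) (u∘u⁻¹ l) (staysInBlock _))
            (SameBlock-trans (Cw u) (τ-SameBlock (Cw u) j valid (λ cut → proj₂ cut supp))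
              (SameBlock-sym (Cw u) (subst (SameBlock (Cw u) _) (u∘u⁻¹ r) (staysInBlock _))))
        ascent : lookup y l F.< lookup y r
        ascent = subst₂ F._<_ (sym (lookup-· v u⁻¹ l)) (sym (lookup-· v u⁻¹ r))
          (SameOrderOnBlocks⇒monotone (Cw u) {v} {u} v-inj sameOrder preimagesInBlock
            (subst₂ F._<_ (sym (u∘u⁻¹ l)) (sym (u∘u⁻¹ r)) (τ-left<τ-right j valid)))

mainTheorem7 : (n : ℕ) (u v : Word n) → IsPerm u → IsPerm v →
    ((u ≼ v) ⇔ IsStdT (Cw u) v u) ×
    ((u ≼ v) ⇔ (Cw v ⊆G Cw u × ∃ λ σ → IsStdT (Cw u) v σ × IsStdT (Cw u) u σ))
mainTheorem7 n u v u-inj v-inj =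
  mk⇔ (≼⇒IsStdT u u-inj v) (IsStdT⇒≼ u u-inj v v-inj) ,
  mk⇔ (λ u≼v → ≼⇒Cw⊆Cw u u-inj v v-inj u≼v , u , ≼⇒IsStdT u u-inj v u≼v , IsStdT-self u u-inj)
      (λ { (_ , σ , (_ , _ , vσ) , (_ , _ , uσ)) →
           IsStdT⇒≼ u u-inj v v-inj (u-inj , staysInBlock u u-inj , SameOrderOnBlocks-trans (Cw u) {v} {u} {σ} vσ uσ) })
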